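{- Let $\mathcal{T}$ be a single-elimination tournament and $\mathcal{B}$ a set of brackets of $\mathcal{T}$. If there exist two distinct players $a,b$ such that $B_i(x_{a,b})\notin\{a,b\}$ for every $B_i\in\mathcal{B}$, then $\mathcal{B}$ is not $\sigma$-resolving for any scoring system $\sigma$.
   Context: For a digraph, $N^+(v)$ is the set of out-neighbours of $v$ and $N^-(v)$ the set of in-neighbours; a sink has $N^+(v)=\emptyset$, a source has $N^-(v)=\emptyset$. A single-elimination tournament $\mathcal{T}$ is a finite digraph with: exactly one sink; $|N^+(v)|=1$ for every non-sink $v$; no directed cycles; and $|N^-(v)|\ne 1$ for every vertex $v$. Players $P(\mathcal{T})$ are the sources; matches $M(\mathcal{T})$ are the non-sources. A directed walk from $u_1$ to $u_t$ is a sequence $(u_1,\dots,u_t)$, $t\ge1$, with $u_{i+1}\in N^+(u_i)$; the player set $P(u)$ of a vertex $u$ is the set of players $a$ with a directed walk from $a$ to $u$. For distinct players $a,b$, $x_{a,b}$ denotes the unique match $x$ having in-neighbours $u_a,u_b\in N^-(x)$ with $P(u_a)\cap\{a,b\}=\{a\}$ and $P(u_b)\cap\{a,b\}=\{b\}$ (such a match exists and is unique). A bracket is a function $B:V(\mathcal{T})\to P(\mathcal{T})$ with $B(a)=a$ for every player $a$ and $B(x)\in\{B(u):u\in N^-(x)\}$ for every match $x$. A scoring system is a function $\sigma:M(\mathcal{T})\to\mathbb{R}_{>0}$; $\mathrm{score}_\sigma(B,B')=\sum_{x\in M(\mathcal{T}):B(x)=B'(x)}\sigma(x)$. A set of brackets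 $\mathcal{B}$ is $\sigma$-resolving if for all pairs of distinct brackets $B,B'$ there is $B_i\in\mathcal{B}$ with $\mathrm{score}_\sigma(B_i,B)\ne\mathrm{score}_\sigma(B_i,B')$. -}

module Defs where

open import Level using (Level; _⊔_; suc)
open import Data.Nat using (ℕ)
open import Data.Bool using (Bool; true; false; if_then_else_)
open import Data.Fin using (Fin; _≟_)
open import Data.Fin.Subset using (Subset; ∣_∣)
open import Data.Vec using (tabulate)
open import Data.List using (List; foldr; allFin)
open import Data.Product using (Σ; Σ-syntax; _×_; ∃)
open import Relation.Nullary using (¬_; does)
open import Relation.Nullary.Decidable using (_×-dec_)
open import Relation.Binary.PropositionalEquality using (_≡_; _≢_)
open import Algebra.Bundles using (CommutativeMonoid)
import Data.Nat as ℕ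

Digraph : ℕ → Set
Digraph n = Fin n → Fin n → Bool

module _ {n : ℕ} (G : Digraph n) where

  Edge : Fin n → Fin n → Set
  Edge u v = G u v ≡ true

  N⁺ : Fin n → Subset n
  N⁺ v = tabulate (λ w → G v w)

  N⁻ : Fin n → Subset n
  N⁻ v = tabulate (λ w → G w v)

  IsSink : Fin n → Set
  IsSink v = ∣ N⁺ v ∣ ≡ 0

  IsSource : Fin n → Set
  IsSource v = ∣ N⁻ v ∣ ≡ 0

  data Walk : Fin n → Fin n → Set where
    [] : ∀ {u} → Walk u u
    _∷_ : ∀ {u w v} → Edge u w → Walk w v → Walk u v

  HasDirectedCycle : Set
  HasDirectedCycle = Σ[ u ∈ Fin n ] Σ[ w ∈ Fin n ] (Edge u w × Walk w u)

  record IsSET : Set where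
    field
      uniqueSink  : Σ[ s ∈ Fin n ] (IsSink s × (∀ v → IsSink v → v ≡ s))
      outdegOne   : ∀ v → ¬ IsSink v → ∣ N⁺ v ∣ ≡ 1
      acyclic     : ¬ HasDirectedCycle
      indegNotOne : ∀ v → ∣ N⁻ v ∣ ≢ 1

  IsPlayer : Fin n → Set
  IsPlayer = IsSource

  IsMatch : Fin n → Set
  IsMatch v = ¬ IsSource v

  _∈P_ : Fin n → Fin n → Set
  a ∈P u = IsPlayer a × Walk a u

  IsXab : Fin n → Fin n → Fin n → Set
  IsXab a b x = IsMatch x × Σ[ ua ∈ Fin n ] Σ[ ub ∈ Fin n ]
    (Edge ua x × Edge ub x
     × (a ∈P ua) × ¬ (b ∈P ua)
     × (b ∈P ub) × ¬ (a ∈P ub))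

  record IsBracket (B : Fin n → Fin n) : Set where
    field
      intoPlayers : ∀ v → IsPlayer (B v)
      onPlayers   : ∀ a → IsPlayer a → B a ≡ a
      onMatches   : ∀ x → IsMatch x → Σ[ u ∈ Fin n ] (Edge u x × B x ≡ B u)

  isMatch? : (v : Fin n) → Bool
  isMatch? v with ∣ N⁻ v ∣
  ... | ℕ.zero = false
  ... | ℕ.suc _ = true

  module _ {c ℓ : Level} (M : CommutativeMonoid c ℓ) where
    open CommutativeMonoid M

    score : (Fin n → Carrier) → (Fin n → Fin n) → (Fin n → Fin n) → Carrier
    score σ B B' = foldr (λ x acc →
        (if isMatch? x then (if does (B x ≟ B' x) then σ x else ε) else ε) ∙ acc)
      ε (allFin n)

    Resolving : (Fin n → Carrier) → ((Fin n → Fin n) → Set) → Set ℓ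
    Resolving σ 𝓑 = ∀ B B' → IsBracket B → IsBracket B' →
      (Σ[ v ∈ Fin n ] B v ≢ B' v) →
      Σ[ Bi ∈ (Fin n → Fin n) ] (𝓑 Bi × ¬ (score σ Bi B ≈ score σ Bi B'))

{-# OPTIONS --safe #-}
-- Let Ba (resp. Bb) send each vertex v to the first player of P(v) in the priority
-- order a, b, 0, 1, …, n-1 (resp. b, a, 0, 1, …).  Both are brackets, and they differ
-- at the sink, where they pick a and b.  They agree at every v with {a, b} ⊈ P(v).
-- If a, b ∈ P(v), a bracket avoiding a and b at x_{a,b} avoids them at v as well:
-- either v = x_{a,b}, or a, b ∈ P(u) for a single child u of v, and the winner of v
-- comes from u (induction) or from a sibling of u, whose player set is disjoint from
-- P(u).  So every bracket of 𝓑 gives Ba and Bb the same score term by term, whatever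
-- σ is.
module Submission where

open import Defs
open import Level using (Level)
open import Data.Nat using (ℕ)
open import Data.Fin using (Fin)
open import Data.Product using (_×_)
open import Relation.Nullary using (¬_)
open import Relation.Binary.PropositionalEquality using (_≢_)
open import Algebra.Bundles using (CommutativeMonoid)

open import Data.Bool using (Bool; true; if_then_else_)
import Data.Bool as Bool
open import Data.Fin using (toℕ; _≟_)
open import Data.Fin.Properties using (pigeonhole; toℕ≤pred[n]; any?)
open import Data.Fin.Subset using (Subset; _∈_; Nonempty; ∣_∣)
open import Data.Fin.Subset.Properties
  using (nonempty?; Empty-unique; ∣⊥∣≡0; x∈p⇒∣p-x∣<∣p∣; x∈p∧x≢y⇒x∈p-y)
open import Data.List using (List; []; _∷_; allFin; find)
open import Data.List.Properties using (foldr-cong)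
open import Data.List.Relation.Unary.Any as Any using (Any; here; there)
open import Data.List.Membership.Propositional.Properties using (∈-allFin)
open import Data.Maybe using (fromMaybe)
import Data.Nat as ℕ
open import Data.Nat using (zero; suc; _≤_; _<_; z≤n; s≤s)
open import Data.Nat.Properties using (≤-pred; <⇒≤; <⇒≢; ≤-trans; ≤-<-trans; <-≤-trans; ≰⇒>; n<1+n; m<n⇒n≢0)
open import Data.Product using (∃; _,_; proj₁; proj₂)
open import Data.Sum using (_⊎_; inj₁; inj₂)
open import Data.Vec using (tabulate)
open import Data.Vec.Properties using (lookup∘tabulate; lookup⇒[]=; []=⇒lookup)
open import Function using (_∘_; flip)
open import Induction.WellFounded using (Acc; acc; WellFounded)
open import Relation.Binary.PropositionalEquality using (_≡_; refl; sym; trans; cong; subst; subst₂; module ≡-Reasoning)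
open import Relation.Nullary using (Dec; yes; no; does; contradiction)
import Relation.Nullary.Decidable as Dec
open import Relation.Nullary.Decidable using (_×-dec_; dec-false)
open import Relation.Unary using (Pred; Decidable; _⊆_)

module _ {n : ℕ} where

  ∣p∣≢0⇒Nonempty : {p : Subset n} → ∣ p ∣ ≢ 0 → Nonempty p
  ∣p∣≢0⇒Nonempty {p} ∣p∣≢0 with nonempty? p
  ... | yes nonempty = nonempty
  ... | no empty = contradiction (trans (cong ∣_∣ (Empty-unique empty)) (∣⊥∣≡0 n)) ∣p∣≢0

  x∈p⇒0<∣p∣ : ∀ {x} {p : Subset n} → x ∈ p → 0 < ∣ p ∣
  x∈p⇒0<∣p∣ x∈p = ≤-<-trans z≤n (x∈p⇒∣p-x∣<∣p∣ x∈p)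

  x∈p∧y∈p∧x≢y⇒1<∣p∣ : ∀ {x y} {p : Subset n} → x ∈ p → y ∈ p → x ≢ y → 1 < ∣ p ∣
  x∈p∧y∈p∧x≢y⇒1<∣p∣ x∈p y∈p x≢y =
    ≤-<-trans (x∈p⇒0<∣p∣ (x∈p∧x≢y⇒x∈p-y y∈p (x≢y ∘ sym))) (x∈p⇒∣p-x∣<∣p∣ x∈p)

module _ {n : ℕ} (g : Fin n → Bool) {x : Fin n} where

  ∈-tabulate⁺ : g x ≡ true → x ∈ tabulate g
  ∈-tabulate⁺ gx = lookup⇒[]= x _ (trans (lookup∘tabulate g x) gx)

  ∈-tabulate⁻ : x ∈ tabulate g → g x ≡ true
  ∈-tabulate⁻ x∈ = trans (sym (lookup∘tabulate g x)) ([]=⇒lookup x∈)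

module _ {a : Level} {A : Set a} where

  first : ∀ {p} {P : Pred A p} → Decidable P → A → List A → A
  first P? d xs = fromMaybe d (find P? xs)

  module _ {p} {P : Pred A p} (P? : Decidable P) {d : A} where

    first-head : ∀ {x xs} → P x → first P? d (x ∷ xs) ≡ x
    first-head {x} px with P? x
    ... | yes _ = refl
    ... | no ¬px = contradiction px ¬px

    first-satisfies : ∀ {xs} → Any P xs → P (first P? d xs)
    first-satisfies {x ∷ _} any with P? x
    ... | yes px = px
    first-satisfies (here px) | no ¬px = contradiction px ¬px
    first-satisfies (there any) | no _ = first-satisfies any

    first-swap : ∀ {x y xs} → ¬ (P x × P y) →
                 first P? d (x ∷ y ∷ xs) ≡ first P? d (y ∷ x ∷ xs)
    first-swap {x} {y} ¬both with P? x | P? y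
    ... | yes px | yes py = contradiction (px , py) ¬both
    ... | yes _  | no _   = refl
    ... | no _   | yes _  = refl
    ... | no _   | no _   = refl

    first-⊆ : ∀ {q} {Q : Pred A q} (Q? : Decidable Q) {d′ xs} → Q ⊆ P → Any P xs →
              Q (first P? d xs) → first Q? d′ xs ≡ first P? d xs
    first-⊆ Q? {xs = x ∷ _} Q⊆P any q with P? x | Q? x
    ... | yes _  | yes _  = refl
    ... | yes _  | no ¬qx = contradiction q ¬qx
    ... | no ¬px | yes qx = contradiction (Q⊆P qx) ¬px
    first-⊆ Q? Q⊆P (here px)  q | no ¬px | no _ = contradiction px ¬px
    first-⊆ Q? Q⊆P (there any) q | no _  | no _ = first-⊆ Q? Q⊆P any q

module _ {n : ℕ} (G : Digraph n) where

  _∷ʳ_ : ∀ {u v w} → Walk G u v → Edge G v w → Walk G u w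
  [] ∷ʳ e = e ∷ []
  (e′ ∷ p) ∷ʳ e = e′ ∷ (p ∷ʳ e)

  unsnoc : ∀ {u v} → Walk G u v → u ≡ v ⊎ ∃ λ w → Walk G u w × Edge G w v
  unsnoc [] = inj₁ refl
  unsnoc (e ∷ p) with unsnoc p
  ... | inj₁ refl = inj₂ (_ , [] , e)
  ... | inj₂ (w , p′ , e′) = inj₂ (w , e ∷ p′ , e′)

  length : ∀ {u v} → Walk G u v → ℕ
  length [] = 0
  length (_ ∷ p) = suc (length p)

  length-∷ʳ : ∀ {u v w} (p : Walk G u v) (e : Edge G v w) → length (p ∷ʳ e) ≡ suc (length p)
  length-∷ʳ [] e = refl
  length-∷ʳ (_ ∷ p) e = cong suc (length-∷ʳ p e)

  vertexAt : ∀ {u v} → Walk G u v → ℕ → Fin n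
  vertexAt {u} [] _ = u
  vertexAt {u} (_ ∷ _) zero = u
  vertexAt (_ ∷ p) (suc i) = vertexAt p i

  vertexAt-0 : ∀ {u v} (p : Walk G u v) → vertexAt p 0 ≡ u
  vertexAt-0 [] = refl
  vertexAt-0 (_ ∷ _) = refl

  vertexAt-edge : ∀ {u v} (p : Walk G u v) {i} → i < length p →
                  Edge G (vertexAt p i) (vertexAt p (suc i))
  vertexAt-edge {u} (e ∷ p) {zero} _ = subst (Edge G u) (sym (vertexAt-0 p)) e
  vertexAt-edge (_ ∷ p) {suc i} (s≤s i<len) = vertexAt-edge p i<len

  vertexAt-walk : ∀ {u v} (p : Walk G u v) {i j} → i ≤ j → Walk G (vertexAt p i) (vertexAt p j)
  vertexAt-walk [] _ = []
  vertexAt-walk (_ ∷ _) {zero} {zero} _ = []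
  vertexAt-walk (e ∷ p) {zero} {suc j} _ =
    e ∷ subst (λ w → Walk G w (vertexAt p j)) (vertexAt-0 p) (vertexAt-walk p z≤n)
  vertexAt-walk (_ ∷ p) {suc i} {suc j} (s≤s i≤j) = vertexAt-walk p i≤j

  bounded-walks-into⇒Acc : ∀ k v → (∀ {u} (p : Walk G u v) → length p ≤ k) → Acc (Edge G) v
  bounded-walks-into⇒Acc zero v bounded = acc λ e → contradiction (bounded (e ∷ [])) λ ()
  bounded-walks-into⇒Acc (suc k) v bounded = acc λ {u} e → bounded-walks-into⇒Acc k u λ p →
    ≤-pred (subst (_≤ suc k) (length-∷ʳ p e) (bounded (p ∷ʳ e)))

  bounded-walks-from⇒Acc : ∀ k u → (∀ {v} (p : Walk G u v) → length p ≤ k) → Acc (flip (Edge G)) u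
  bounded-walks-from⇒Acc zero u bounded = acc λ e → contradiction (bounded (e ∷ [])) λ ()
  bounded-walks-from⇒Acc (suc k) u bounded = acc λ {v} e →
    bounded-walks-from⇒Acc k v λ p → ≤-pred (bounded (e ∷ p))

  Edge⇒¬IsSource : ∀ {u v} → Edge G u v → ¬ IsSource G v
  Edge⇒¬IsSource {v = v} e = m<n⇒n≢0 (x∈p⇒0<∣p∣ (∈-tabulate⁺ (λ w → G w v) e))

  Edge⇒¬IsSink : ∀ {u v} → Edge G u v → ¬ IsSink G u
  Edge⇒¬IsSink {u} e = m<n⇒n≢0 (x∈p⇒0<∣p∣ (∈-tabulate⁺ (G u) e))

  ¬IsSource⇒Edge : ∀ {v} → ¬ IsSource G v → ∃ λ u → Edge G u v
  ¬IsSource⇒Edge {v} ¬source with u , u∈ ← ∣p∣≢0⇒Nonempty ¬source = u , ∈-tabulate⁻ (λ w → G w v) u∈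

  ¬IsSink⇒Edge : ∀ {u} → ¬ IsSink G u → ∃ λ v → Edge G u v
  ¬IsSink⇒Edge {u} ¬sink with v , v∈ ← ∣p∣≢0⇒Nonempty ¬sink = v , ∈-tabulate⁻ (G u) v∈

  IsSource? : ∀ v → Dec (IsSource G v)
  IsSource? v = ∣ N⁻ G v ∣ ℕ.≟ 0

  IsSink? : ∀ v → Dec (IsSink G v)
  IsSink? v = ∣ N⁺ G v ∣ ℕ.≟ 0

  IsSource-walk⇒≡ : ∀ {u v} → IsSource G v → Walk G u v → u ≡ v
  IsSource-walk⇒≡ source p with unsnoc p
  ... | inj₁ u≡v = u≡v
  ... | inj₂ (_ , _ , e) = contradiction source (Edge⇒¬IsSource e)

  PlayerSet : Fin n → Pred (Fin n) Level.zero
  PlayerSet v a = _∈P_ G a v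

  PlayerSet-mono : ∀ {u v} → Edge G u v → PlayerSet u ⊆ PlayerSet v
  PlayerSet-mono e (player , p) = player , p ∷ʳ e

  module Acyclic (acyclic : ¬ HasDirectedCycle G) where

    length<n : ∀ {u v} (p : Walk G u v) → length p < n
    length<n p = ≰⇒> λ n≤length → acyclic (cycle n≤length)
      where
      cycle : n ≤ length p → HasDirectedCycle G
      cycle n≤length
        with i , j , i<j , same ← pigeonhole (n<1+n n) (λ (k : Fin (suc n)) → vertexAt p (toℕ k))
        = _ , _ , vertexAt-edge p (<-≤-trans i<j (≤-trans (toℕ≤pred[n] j) n≤length))
        , subst (Walk G _) (sym same) (vertexAt-walk p i<j)

    Edge-wellFounded : WellFounded (Edge G)
    Edge-wellFounded v = bounded-walks-into⇒Acc n v λ p → <⇒≤ (length<n p)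

    flip-Edge-wellFounded : WellFounded (flip (Edge G))
    flip-Edge-wellFounded u = bounded-walks-from⇒Acc n u λ p → <⇒≤ (length<n p)

    Walk? : ∀ q v → Dec (Walk G q v)
    Walk? q v = go v (Edge-wellFounded v)
      where
      go : ∀ v → Acc (Edge G) v → Dec (Walk G q v)
      go v (acc rs) with q ≟ v
      ... | yes refl = yes []
      ... | no q≢v = Dec.map′ (λ (u , e , p) → p ∷ʳ e) last-edge (any? step)
        where
        step : ∀ u → Dec (Edge G u v × Walk G q u)
        step u with G u v Bool.≟ true
        ... | yes e = Dec.map′ (e ,_) proj₂ (go u (rs e))
        ... | no ¬e = no (¬e ∘ proj₁)
        last-edge : Walk G q v → ∃ λ u → Edge G u v × Walk G q u
        last-edge p with unsnoc p
        ... | inj₁ q≡v = contradiction q≡v q≢v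
        ... | inj₂ (u , p′ , e) = u , e , p′

    PlayerSet? : ∀ v → Decidable (PlayerSet v)
    PlayerSet? v a = IsSource? a ×-dec Walk? a v

    PlayerSet-nonempty : ∀ v → ∃ (PlayerSet v)
    PlayerSet-nonempty v = go v (Edge-wellFounded v)
      where
      go : ∀ v → Acc (Edge G) v → ∃ (PlayerSet v)
      go v (acc rs) with IsSource? v
      ... | yes source = v , source , []
      ... | no match with u , e ← ¬IsSource⇒Edge match
                     with a , a∈ ← go u (rs e) = a , PlayerSet-mono e a∈

    bracket-PlayerSet : ∀ {B} → IsBracket G B → ∀ v → PlayerSet v (B v)
    bracket-PlayerSet {B} bracket v = go v (Edge-wellFounded v)
      where
      open IsBracket bracket
      go : ∀ v → Acc (Edge G) v → PlayerSet v (B v)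
      go v (acc rs) with IsSource? v
      ... | yes source = subst (PlayerSet v) (sym (onPlayers v source)) (source , [])
      ... | no match with u , e , Bv≡Bu ← onMatches v match =
        subst (PlayerSet v) (sym Bv≡Bu) (PlayerSet-mono e (go u (rs e)))

    PlayerSet-meets-allFin : ∀ v → Any (PlayerSet v) (allFin n)
    PlayerSet-meets-allFin v with a , a∈v ← PlayerSet-nonempty v =
      Any.map (λ a≡ → subst (PlayerSet v) a≡ a∈v) (∈-allFin a)

    firstPlayer : List (Fin n) → Fin n → Fin n
    firstPlayer priority v = first (PlayerSet? v) v priority

    firstPlayer-isBracket : ∀ priority → (∀ v → Any (PlayerSet v) priority) →
                            IsBracket G (firstPlayer priority)
    firstPlayer-isBracket priority covers = record
      { intoPlayers = λ v → proj₁ (chosen v)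
      ; onPlayers   = λ a player → IsSource-walk⇒≡ player (proj₂ (chosen a))
      ; onMatches   = lastMatch
      }
      where
      chosen : ∀ v → PlayerSet v (firstPlayer priority v)
      chosen v = first-satisfies (PlayerSet? v) (covers v)
      lastMatch : ∀ v → IsMatch G v → ∃ λ u → Edge G u v × firstPlayer priority v ≡ firstPlayer priority u
      lastMatch v match with player , p ← chosen v | unsnoc p
      ... | inj₁ chosen≡v = contradiction (subst (IsSource G) chosen≡v player) match
      ... | inj₂ (u , p′ , e) =
        u , e , sym (first-⊆ (PlayerSet? v) (PlayerSet? u) (PlayerSet-mono e) (covers v) (player , p′))

    module Functional (functional : ∀ {u v w} → Edge G u v → Edge G u w → v ≡ w) where

      walks-comparable : ∀ {q v w} → Walk G q v → Walk G q w → Walk G v w ⊎ Walk G w v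
      walks-comparable [] p = inj₁ p
      walks-comparable (e ∷ p) [] = inj₂ (e ∷ p)
      walks-comparable (e ∷ p) (e′ ∷ p′) with refl ← functional e e′ = walks-comparable p p′

      sibling-¬Walk : ∀ {w u v} → Edge G w v → Edge G u v → w ≢ u → ¬ Walk G w u
      sibling-¬Walk _ _ w≢u [] = w≢u refl
      sibling-¬Walk ew eu _ (e ∷ p) with refl ← functional ew e = acyclic (_ , _ , eu , p)

      siblings-disjoint : ∀ {w u v} → Edge G w v → Edge G u v → w ≢ u →
                          ∀ {q} → PlayerSet w q → ¬ PlayerSet u q
      siblings-disjoint ew eu w≢u (_ , pw) (_ , pu) with walks-comparable pw pu
      ... | inj₁ w→u = sibling-¬Walk ew eu w≢u w→u
      ... | inj₂ u→w = sibling-¬Walk eu ew (w≢u ∘ sym) u→w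

      module _ {a b : Fin n} (a≢b : a ≢ b) where

        last-edges : ∀ {v} → PlayerSet v a → PlayerSet v b →
                     ∃ λ ua → ∃ λ ub → (Edge G ua v × PlayerSet ua a) × (Edge G ub v × PlayerSet ub b)
        last-edges (a-player , pa) (b-player , pb) with unsnoc pa | unsnoc pb
        ... | inj₁ refl | _ = contradiction (IsSource-walk⇒≡ a-player pb) (a≢b ∘ sym)
        ... | _ | inj₁ refl = contradiction (IsSource-walk⇒≡ b-player pa) a≢b
        ... | inj₂ (ua , pa′ , ea) | inj₂ (ub , pb′ , eb) =
          ua , ub , (ea , a-player , pa′) , (eb , b-player , pb′)

        siblings-IsXab : ∀ {ua ub v} → Edge G ua v → Edge G ub v → ua ≢ ub →
                         PlayerSet ua a → PlayerSet ub b → IsXab G a b v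
        siblings-IsXab ea eb ua≢ub a∈ua b∈ub =
          Edge⇒¬IsSource ea , _ , _ , ea , eb
          , a∈ua , (λ b∈ua → siblings-disjoint ea eb ua≢ub b∈ua b∈ub)
          , b∈ub , (λ a∈ub → siblings-disjoint ea eb ua≢ub a∈ua a∈ub)

        bracket-avoids-above-xab : ∀ {B} → IsBracket G B →
          (∀ x → IsXab G a b x → B x ≢ a × B x ≢ b) →
          ∀ v → PlayerSet v a → PlayerSet v b → B v ≢ a × B v ≢ b
        bracket-avoids-above-xab {B} bracket avoids v = go v (Edge-wellFounded v)
          where
          open IsBracket bracket
          go : ∀ v → Acc (Edge G) v → PlayerSet v a → PlayerSet v b → B v ≢ a × B v ≢ b
          go v (acc rs) a∈v b∈v
            with ua , ub , (ea , a∈ua) , (eb , b∈ub) ← last-edges a∈v b∈v | ua ≟ ub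
          ... | no ua≢ub = avoids v (siblings-IsXab ea eb ua≢ub a∈ua b∈ub)
          ... | yes refl with w , ew , Bv≡Bw ← onMatches v (Edge⇒¬IsSource ea) | w ≟ ua
          ...   | yes refl = subst (λ c → c ≢ a × c ≢ b) (sym Bv≡Bw) (go w (rs ew) a∈ua b∈ub)
          ...   | no w≢ua = subst (λ c → c ≢ a × c ≢ b) (sym Bv≡Bw)
                  ( (λ Bw≡a → siblings-disjoint ew ea w≢ua (Bw∈ Bw≡a) a∈ua)
                  , (λ Bw≡b → siblings-disjoint ew ea w≢ua (Bw∈ Bw≡b) b∈ub) )
            where
            Bw∈ : ∀ {c} → B w ≡ c → PlayerSet w c
            Bw∈ Bw≡c = subst (PlayerSet w) Bw≡c (bracket-PlayerSet bracket w)

        swapped-priorities-agree-or-avoided : ∀ {B} L → IsBracket G B →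
          (∀ x → IsXab G a b x → B x ≢ a × B x ≢ b) → ∀ v →
          let Ba = firstPlayer (a ∷ b ∷ L) v; Bb = firstPlayer (b ∷ a ∷ L) v
          in Ba ≡ Bb ⊎ (B v ≢ Ba × B v ≢ Bb)
        swapped-priorities-agree-or-avoided {B} L bracket avoids v
          with PlayerSet? v a ×-dec PlayerSet? v b
        ... | no ¬both = inj₁ (first-swap (PlayerSet? v) {d = v} {xs = L} ¬both)
        ... | yes (a∈v , b∈v) = inj₂ (subst₂ (λ c c′ → B v ≢ c × B v ≢ c′)
                (sym (first-head (PlayerSet? v) {d = v} {xs = b ∷ L} a∈v))
                (sym (first-head (PlayerSet? v) {d = v} {xs = a ∷ L} b∈v))
                (bracket-avoids-above-xab bracket avoids v a∈v b∈v))

module _ {c ℓ : Level} (M : CommutativeMonoid c ℓ) {n : ℕ} (G : Digraph n) where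
  open CommutativeMonoid M using (Carrier; _∙_; ε)

  score-cong : ∀ σ {B B₁ B₂} → (∀ v → B₁ v ≡ B₂ v ⊎ (B v ≢ B₁ v × B v ≢ B₂ v)) →
               score G M σ B B₁ ≡ score G M σ B B₂
  score-cong σ {B} {B₁} {B₂} agree =
    foldr-cong (λ v s → cong (λ t → summand t v s) (same-test v)) refl (allFin n)
    where
    summand : Bool → Fin n → Carrier → Carrier
    summand t v s = (if isMatch? G v then (if t then σ v else ε) else ε) ∙ s
    same-test : ∀ v → does (B v ≟ B₁ v) ≡ does (B v ≟ B₂ v)
    same-test v with agree v
    ... | inj₁ B₁v≡B₂v = cong (does ∘ (B v ≟_)) B₁v≡B₂v
    ... | inj₂ (B≢B₁ , B≢B₂) = trans (dec-false (B v ≟ B₁ v) B≢B₁) (sym (dec-false (B v ≟ B₂ v) B≢B₂))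

module _ {n : ℕ} {G : Digraph n} (T : IsSET G) where
  open IsSET T
  open Acyclic G acyclic

  Edge-functional : ∀ {u v w} → Edge G u v → Edge G u w → v ≡ w
  Edge-functional {u} {v} {w} e e′ with v ≟ w
  ... | yes v≡w = v≡w
  ... | no v≢w = contradiction (sym (outdegOne u (Edge⇒¬IsSink G e)))
      (<⇒≢ (x∈p∧y∈p∧x≢y⇒1<∣p∣ (∈-tabulate⁺ (G u) e) (∈-tabulate⁺ (G u) e′) v≢w))

  sink : Fin n
  sink = proj₁ uniqueSink

  Walk-to-sink : ∀ u → Walk G u sink
  Walk-to-sink u = go u (flip-Edge-wellFounded u)
    where
    go : ∀ u → Acc (flip (Edge G)) u → Walk G u sink
    go u (acc rs) with IsSink? G u
    ... | yes u-sink = subst (Walk G u) (proj₂ (proj₂ uniqueSink) u u-sink) []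
    ... | no ¬sink with v , e ← ¬IsSink⇒Edge G ¬sink = e ∷ go v (rs e)

  firstPlayer-sink : ∀ {a} L → IsPlayer G a → firstPlayer (a ∷ L) sink ≡ a
  firstPlayer-sink L player = first-head (PlayerSet? sink) {xs = L} (player , Walk-to-sink _)

proposition4p3 : ∀ {c ℓ p : Level} (M : CommutativeMonoid c ℓ)
    (Pos : CommutativeMonoid.Carrier M → Set p)
    (n : ℕ) (G : Digraph n) → IsSET G →
    (𝓑 : (Fin n → Fin n) → Set) → (∀ B → 𝓑 B → IsBracket G B) →
    (a b : Fin n) → IsPlayer G a → IsPlayer G b → a ≢ b →
    (∀ x → IsXab G a b x → ∀ Bi → 𝓑 Bi → (Bi x ≢ a × Bi x ≢ b)) →
    (σ : Fin n → CommutativeMonoid.Carrier M) → (∀ x → IsMatch G x → Pos (σ x)) →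
    ¬ Resolving G M σ 𝓑
proposition4p3 M _ n G T 𝓑 𝓑-brackets a b a-player b-player a≢b avoids σ _ resolving =
  let Bi , Bi∈𝓑 , Bi-separates =
        resolving Ba Bb (prioritised a b) (prioritised b a) (sink T , Ba≢Bb-at-sink)
  in Bi-separates (reflexive (score-cong M G σ
       (swapped-priorities-agree-or-avoided a≢b (allFin n) (𝓑-brackets Bi Bi∈𝓑)
         (λ x x≡xab → avoids x x≡xab Bi Bi∈𝓑))))
  where
  open CommutativeMonoid M using (reflexive)
  open Acyclic G (IsSET.acyclic T)
  open Functional (Edge-functional T)

  prioritised : ∀ x y → IsBracket G (firstPlayer (x ∷ y ∷ allFin n))
  prioritised x y = firstPlayer-isBracket _ λ v → there (there (PlayerSet-meets-allFin v))

  Ba Bb : Fin n → Fin n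
  Ba = firstPlayer (a ∷ b ∷ allFin n)
  Bb = firstPlayer (b ∷ a ∷ allFin n)

  Ba≢Bb-at-sink : Ba (sink T) ≢ Bb (sink T)
  Ba≢Bb-at-sink Ba≡Bb = a≢b (begin
    a            ≡⟨ firstPlayer-sink T (b ∷ allFin n) a-player ⟨
    Ba (sink T)  ≡⟨ Ba≡Bb ⟩
    Bb (sink T)  ≡⟨ firstPlayer-sink T (a ∷ allFin n) b-player ⟩
    b            ∎)
    where open ≡-Reasoning
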